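{- Let $\mathcal{F}$ be the free non-symmetric operad on two binary generators $\alpha,\beta$, and let $\pi:\mathcal{F}\to\mathrm{CNCB}$ be the operad morphism with $\pi(\alpha)=\tau_{aab}$ and $\pi(\beta)=\tau_{baa}$. Then $\pi$ induces an isomorphism from $\mathcal{F}/_{\equiv}$ onto the suboperad $\langle\tau_{aab},\tau_{baa}\rangle$, where $\equiv$ is the smallest operad congruence of $\mathcal{F}$ containing $\beta\circ_1\alpha\equiv\alpha\circ_2\beta$.
   Context: A bicoloured noncrossing configuration (BNC) of size $n\ge2$ is a regular polygon with vertices $1,\dots,n+1$ (clockwise) with each arc $(i,j)$, $1\le i<j\le n+1$, coloured blue, red or uncoloured, such that no two coloured (blue or red) arcs cross and red arcs are diagonals. The edges are $(i,i+1)$ for $i\in[n]$ (the $i$-th edge), the base is $(1,n+1)$, and the other arcs are diagonals. There is also a unique BNC of size $1$, a single blue arc (its edge and base). $\mathrm{CNCB}$ is the non-symmetric operad of BNCs (arity = size, unit = the size-$1$ BNC) with composition $\mathfrak{C}\circ_i\mathfrak{D}$ ($\mathfrak{C}$ of size $n$, $\mathfrak{D}$ of size $m$) obtained by gluing the base of $\mathfrak{D}$ onto the $i$-th edge of $\mathfrak{C}$. Vertex $j$ of $\mathfrak{C}$ goes to $j$ if $j\le i$ and to $j+m-1$ otherwise, and vertex $\ell$ of $\mathfrak{D}$ goes to $i+\ell-1$. All other arcs keep their colours. The arc $(i,i+m)$ is red if the $i$-th edge of $\mathfrak{C}$ and the base of $\mathfrak{D}$ are both uncoloured, blue if both are blue,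 and uncoloured otherwise. All remaining arcs are uncoloured. For $x,y,z\in\{a,b\}$, $\tau_{xyz}$ is the BNC of size $2$ (a triangle, which has no diagonals) whose first edge $(1,2)$, base $(1,3)$ and second edge $(2,3)$ are respectively coloured $x,y,z$, where $a$ means blue and $b$ means uncoloured. $\langle G\rangle$ denotes the smallest suboperad of $\mathrm{CNCB}$ containing $G$. -}

module Defs where

open import Data.Nat using (ℕ; zero; suc; _+_; _∸_; _≤_; _<_; _≤ᵇ_; _≡ᵇ_)
open import Data.Bool using (Bool; true; false; if_then_else_; _∧_; _∨_)
open import Data.Product using (Σ; _×_; _,_)
open import Relation.Binary.PropositionalEquality using (_≡_)
open import Data.Empty using (⊥)
open import Data.Unit using (⊤)

data Colour : Set where
  blue red none : Colour

-- A (raw) colouring of the arcs of a polygon: arc (p , q) with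
-- 1 ≤ p < q ≤ n+1 has colour  c p q  (vertices are 1-based naturals).
-- Values outside this range are irrelevant (see _≈B[_]_ below).
Col : Set
Col = ℕ → ℕ → Colour

Crossing : ℕ → ℕ → ℕ → ℕ → Set
Crossing p q r s = (p < r) × (r < q) × (q < s)


IsColoured : Colour → Set
IsColoured none = ⊥
IsColoured _    = ⊤

IsBNC : ℕ → Col → Set
IsBNC n c =
  (∀ p q r s → 1 ≤ p → q ≤ suc n → s ≤ suc n → Crossing p q r s →
     IsColoured (c p q) → IsColoured (c r s) → ⊥)
  ×
  (∀ p q → 1 ≤ p → p < q → q ≤ suc n → c p q ≡ red →
     (q ≡ suc p → ⊥) × ((p ≡ 1 × q ≡ suc n) → ⊥))

_≈B[_]_ : Col → ℕ → Col → Set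
c ≈B[ n ] d = ∀ p q → 1 ≤ p → p < q → q ≤ suc n → c p q ≡ d p q

unitB : Col
unitB p q = if (p ≡ᵇ 1) ∧ (q ≡ᵇ 2) then blue else none

-- Colour of the arc (i, i+m) in a composition, from the colour x of the
-- i-th edge of C and the colour y of the base of D.
glue : Colour → Colour → Colour
glue blue blue = blue
glue none none = red
glue _    _    = none

-- Partial composition  C ∘ᵢ D  where D has size m (C's size is not needed).
-- Vertices j of C go to j (j ≤ i) or j+m-1 (j > i); vertex ℓ of D goes
-- to i+ℓ-1.
compB : (m i : ℕ) → Col → Col → Col
compB m i C D p q =
  if (i ≤ᵇ p) ∧ (q ≤ᵇ i + m)
  then (if (p ≡ᵇ i) ∧ (q ≡ᵇ i + m)
        then glue (C i (suc i)) (D 1 (suc m))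
        else D (suc (p ∸ i)) (suc (q ∸ i)))
  else (if inC p ∧ inC q then C (back p) (back q) else none)
  where
    inC : ℕ → Bool
    inC j = (j ≤ᵇ i) ∨ ((i + m) ≤ᵇ j)
    back : ℕ → ℕ
    back j = if j ≤ᵇ i then j else j ∸ (m ∸ 1)

-- The triangles τ_xyz: edge (1,2) coloured x, base (1,3) coloured y,
-- edge (2,3) coloured z; a = blue, b = uncoloured.
triangle : Colour → Colour → Colour → Col
triangle x y z 1 2 = x
triangle x y z 1 3 = y
triangle x y z 2 3 = z
triangle x y z _ _ = none

τaab : Col
τaab = triangle blue blue none

τbaa : Col
τbaa = triangle none blue blue

-- The suboperad ⟨τaab, τbaa⟩ of CNCB: smallest set of BNCs containing
-- the unit and the generators and closed under partial composition
-- (membership is taken up to equality of BNCs, ≈B).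
data InGen : ℕ → Col → Set where
  g-unit : InGen 1 unitB
  g-aab  : InGen 2 τaab
  g-baa  : InGen 2 τbaa
  g-comp : ∀ {n m i c d} → InGen n c → InGen m d → 1 ≤ i → i ≤ n →
           InGen (n + m ∸ 1) (compB m i c d)
  g-resp : ∀ {n c d} → InGen n c → c ≈B[ n ] d → InGen n d

data Gen : Set where
  α β : Gen

-- Planar binary trees with internal nodes labelled by generators;
-- arity = number of leaves.  node g l r  =  (g ∘₂ r) ∘₁ l.
data Tree : Set where
  leaf : Tree
  node : Gen → Tree → Tree → Tree

arity : Tree → ℕ
arity leaf = 1
arity (node _ l r) = arity l + arity r

-- Partial composition s ∘ᵢ t (grafting t on the i-th leaf of s, 1-based).
graft : Tree → ℕ → Tree → Tree
graft leaf i t = t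
graft (node g l r) i t =
  if i ≤ᵇ arity l then node g (graft l i t) r
  else node g l (graft r (i ∸ arity l) t)

gen : Gen → Tree
gen g = node g leaf leaf

data _≡F_ : Tree → Tree → Set where
  rel   : graft (gen β) 1 (gen α) ≡F graft (gen α) 2 (gen β)
  c-refl  : ∀ {s} → s ≡F s
  c-sym   : ∀ {s t} → s ≡F t → t ≡F s
  c-trans : ∀ {s t u} → s ≡F t → t ≡F u → s ≡F u
  c-comp  : ∀ {s s' t t' i} → s ≡F s' → t ≡F t' → 1 ≤ i → i ≤ arity s →
            graft s i t ≡F graft s' i t'

τ : Gen → Col
τ α = τaab
τ β = τbaa

π : Tree → Col
π leaf = unitB
π (node g l r) = compB (arity l) 1 (compB (arity r) 2 (τ g) (π r)) (π l)

module Submission where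

open import Defs
open import Data.Nat using (ℕ; zero; suc; _+_; _∸_; _≤_; _<_; _≤ᵇ_; _≡ᵇ_; z≤n; s≤s)
open import Data.Nat.Properties
open import Data.Bool using (true; false; if_then_else_; _∧_; T)
open import Data.Bool.Properties using (∧-zeroʳ)
open import Data.Product using (Σ; _×_; _,_)
open import Data.Sum using (_⊎_; inj₁; inj₂)
open import Data.Empty using (⊥; ⊥-elim)
open import Data.Unit using (⊤; tt)
open import Relation.Nullary using (¬_; yes; no)
open import Relation.Nullary.Decidable using (_×-dec_)
open import Relation.Binary.PropositionalEquality
open import Relation.Binary.Definitions using (tri<; tri≈; tri>)
open import Function using (_∘_)
open import Data.Nat.Tactic.RingSolver using (solve-∀)
open import Function.Bundles using (_⇔_; mk⇔)

-- π t has an explicit description: the arc spanned by a subtree of t is coloured by the edge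
-- of the generator that subtree hangs from (the base being blue), and every other arc is
-- uncoloured; in particular no red arc appears.  Checking that this description turns
-- grafting into partial composition shows that π is an operad morphism, so π respects ≡
-- (both sides of the relation have the same image) and its image is the suboperad generated
-- by τaab and τbaa.  For injectivity, the rotation β(α(u,v),y) → α(u,β(v,y)) brings every
-- tree to a normal form in which the left subtree of a β-node is a left comb of β's.  On
-- normal forms of arity n the description determines the root: for an α-root with left
-- subtree l, (1, 1 + arity l) is the longest blue arc from vertex 1 other than the base; a
-- β-root has no such arc, and (1 + arity l, n + 1) is the longest blue arc into vertex n + 1
-- other than the base.

≡ᵇ-refl : ∀ n → (n ≡ᵇ n) ≡ true
≡ᵇ-refl zero    = refl
≡ᵇ-refl (suc n) = ≡ᵇ-refl n

≢⇒≡ᵇ-false : ∀ {m n} → m ≢ n → (m ≡ᵇ n) ≡ false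
≢⇒≡ᵇ-false {zero}  {zero}  m≢n = ⊥-elim (m≢n refl)
≢⇒≡ᵇ-false {zero}  {suc n} _   = refl
≢⇒≡ᵇ-false {suc m} {zero}  _   = refl
≢⇒≡ᵇ-false {suc m} {suc n} m≢n = ≢⇒≡ᵇ-false (m≢n ∘ cong suc)

≤⇒≤ᵇ-true : ∀ {m n} → m ≤ n → (m ≤ᵇ n) ≡ true
≤⇒≤ᵇ-true {m} {n} m≤n with m ≤ᵇ n | ≤⇒≤ᵇ m≤n
... | true | _ = refl

>⇒≤ᵇ-false : ∀ {m n} → n < m → (m ≤ᵇ n) ≡ false
>⇒≤ᵇ-false {m} {n} n<m with m ≤ᵇ n in eq
... | false = refl
... | true  = ⊥-elim (<⇒≱ n<m (≤ᵇ⇒≤ m n (subst T (sym eq) tt)))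

pair-≡ᵇ-true : ∀ p q → ((p ≡ᵇ p) ∧ (q ≡ᵇ q)) ≡ true
pair-≡ᵇ-true p q rewrite ≡ᵇ-refl p | ≡ᵇ-refl q = refl

pair-≡ᵇ-false : ∀ {p q o n} → ¬ (p ≡ o × q ≡ n) → ((p ≡ᵇ o) ∧ (q ≡ᵇ n)) ≡ false
pair-≡ᵇ-false {p} {q} {o} {n} ne with p ≟ o
... | no p≢o rewrite ≢⇒≡ᵇ-false p≢o = refl
... | yes refl with q ≟ n
...   | no q≢n rewrite ≢⇒≡ᵇ-false q≢n = ∧-zeroʳ (p ≡ᵇ p)
...   | yes refl = ⊥-elim (ne (refl , refl))

+-cancelˡ-≡ᵇ : ∀ k x y → (k + x ≡ᵇ k + y) ≡ (x ≡ᵇ y)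
+-cancelˡ-≡ᵇ zero    x y = refl
+-cancelˡ-≡ᵇ (suc k) x y = +-cancelˡ-≡ᵇ k x y

+-cancelˡ-≤ᵇ : ∀ k x y → (k + x ≤ᵇ k + y) ≡ (x ≤ᵇ y)
+-cancelˡ-≤ᵇ zero    x y = refl
+-cancelˡ-≤ᵇ (suc k) x y = trans (suc-≤ᵇ (k + x) (k + y)) (+-cancelˡ-≤ᵇ k x y)
  where
    suc-≤ᵇ : ∀ a b → (suc a ≤ᵇ suc b) ≡ (a ≤ᵇ b)
    suc-≤ᵇ zero    b = refl
    suc-≤ᵇ (suc a) b = refl

+-swapʳ : ∀ a b c → a + b + c ≡ a + c + b
+-swapʳ = solve-∀

1≤arity : ∀ t → 1 ≤ arity t
1≤arity leaf         = s≤s z≤n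
1≤arity (node g l r) = ≤-trans (1≤arity l) (m≤m+n _ _)

arity<arity+arity : ∀ s t → arity s < arity s + arity t
arity<arity+arity s t = m<m+n (arity s) (1≤arity t)

2≤arity+arity : ∀ s t → 2 ≤ arity s + arity t
2≤arity+arity s t = ≤-trans (s≤s (1≤arity t)) (+-monoˡ-≤ (arity t) (1≤arity s))

data Ctx : Set where
  hole : Ctx
  inL  : Gen → Ctx → Tree → Ctx
  inR  : Gen → Tree → Ctx → Ctx

plug : Ctx → Tree → Tree
plug hole        t = t
plug (inL g K r) t = node g (plug K t) r
plug (inR g l K) t = node g l (plug K t)

offset : Ctx → ℕ
offset hole        = 0
offset (inL g K r) = offset K
offset (inR g l K) = arity l + offset K

width : Ctx → ℕ
width hole        = 0
width (inL g K r) = width K + arity r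
width (inR g l K) = arity l + width K

arity-plug : ∀ K t → arity (plug K t) ≡ width K + arity t
arity-plug hole        t = refl
arity-plug (inL g K r) t rewrite arity-plug K t = +-swapʳ (width K) (arity t) (arity r)
arity-plug (inR g l K) t rewrite arity-plug K t = sym (+-assoc (arity l) (width K) (arity t))

offset≤width : ∀ K → offset K ≤ width K
offset≤width hole        = ≤-refl
offset≤width (inL g K r) = ≤-trans (offset≤width K) (m≤m+n (width K) (arity r))
offset≤width (inR g l K) = +-monoʳ-≤ (arity l) (offset≤width K)

offset+arity≤arity-plug : ∀ K t → offset K + arity t ≤ arity (plug K t)
offset+arity≤arity-plug K t = subst (offset K + arity t ≤_) (sym (arity-plug K t))
                                    (+-monoˡ-≤ (arity t) (offset≤width K))

leftColour rightColour : Gen → Colour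
leftColour  α = blue
leftColour  β = none
rightColour α = none
rightColour β = blue

-- π t (see π≈drawing), translated to have base (o, o + arity t), and with base colour c.
draw : Colour → Tree → ℕ → Col
draw c leaf o p q = if (p ≡ᵇ o) ∧ (q ≡ᵇ o + 1) then c else none
draw c (node g l r) o p q =
  if (p ≡ᵇ o) ∧ (q ≡ᵇ o + (arity l + arity r)) then c
  else (if q ≤ᵇ o + arity l then draw (leftColour g) l o p q
  else (if o + arity l ≤ᵇ p then draw (rightColour g) r (o + arity l) p q else none))

drawing : Tree → Col
drawing t = draw blue t 1

draw-base : ∀ c t o → draw c t o o (o + arity t) ≡ c
draw-base c leaf         o rewrite pair-≡ᵇ-true o (o + 1) = refl
draw-base c (node g l r) o rewrite pair-≡ᵇ-true o (o + (arity l + arity r)) = refl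

draw-base-irrelevant : ∀ c c' t o p q → ¬ (p ≡ o × q ≡ o + arity t) → draw c t o p q ≡ draw c' t o p q
draw-base-irrelevant c c' leaf         o p q ¬base rewrite pair-≡ᵇ-false ¬base = refl
draw-base-irrelevant c c' (node g l r) o p q ¬base rewrite pair-≡ᵇ-false ¬base = refl

<⇒¬≡top : ∀ {p q o top : ℕ} → q < top → ¬ (p ≡ o × q ≡ top)
<⇒¬≡top q<top (_ , q≡top) = <-irrefl q≡top q<top

>⇒¬≡bottom : ∀ {p q o top : ℕ} → o < p → ¬ (p ≡ o × q ≡ top)
>⇒¬≡bottom o<p (p≡o , _) = <-irrefl (sym p≡o) o<p

draw-left : ∀ c g l r o p q → q ≤ o + arity l → draw c (node g l r) o p q ≡ draw (leftColour g) l o p q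
draw-left c g l r o p q q≤mid
  rewrite pair-≡ᵇ-false (<⇒¬≡top {p} {q} {o} (≤-<-trans q≤mid (+-monoʳ-< o (arity<arity+arity l r))))
        | ≤⇒≤ᵇ-true q≤mid = refl

draw-right : ∀ c g l r o p q → o + arity l ≤ p → p < q →
             draw c (node g l r) o p q ≡ draw (rightColour g) r (o + arity l) p q
draw-right c g l r o p q mid≤p p<q
  rewrite pair-≡ᵇ-false (>⇒¬≡bottom {p} {q} {o} {o + (arity l + arity r)}
                                     (<-≤-trans (m<m+n o (1≤arity l)) mid≤p))
        | >⇒≤ᵇ-false {q} {o + arity l} (≤-<-trans mid≤p p<q)
        | ≤⇒≤ᵇ-true mid≤p = refl

draw-straddle : ∀ c g l r o p q → p < o + arity l → o + arity l < q →
                ¬ (p ≡ o × q ≡ o + (arity l + arity r)) → draw c (node g l r) o p q ≡ none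
draw-straddle c g l r o p q p<mid mid<q ¬base
  rewrite pair-≡ᵇ-false ¬base | >⇒≤ᵇ-false mid<q | >⇒≤ᵇ-false p<mid = refl

draw-shift : ∀ c t k o p q → draw c t (k + o) (k + p) (k + q) ≡ draw c t o p q
draw-shift c leaf k o p q
  rewrite +-assoc k o 1 | +-cancelˡ-≡ᵇ k p o | +-cancelˡ-≡ᵇ k q (o + 1) = refl
draw-shift c (node g l r) k o p q
  rewrite +-assoc k o (arity l + arity r) | +-cancelˡ-≡ᵇ k p o | +-cancelˡ-≡ᵇ k q (o + (arity l + arity r))
        | +-assoc k o (arity l) | +-cancelˡ-≤ᵇ k q (o + arity l) | +-cancelˡ-≤ᵇ k (o + arity l) p
        | draw-shift (leftColour g) l k o p q | draw-shift (rightColour g) r k (o + arity l) p q = refl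

NotRed : Colour → Set
NotRed blue = ⊤
NotRed red  = ⊥
NotRed none = ⊤

glue-blue : ∀ x → NotRed x → glue x blue ≡ x
glue-blue blue _ = refl
glue-blue none _ = refl

holeColour : Colour → Ctx → Colour
holeColour c hole        = c
holeColour c (inL g K r) = holeColour (leftColour g) K
holeColour c (inR g l K) = holeColour (rightColour g) K

holeColour-notRed : ∀ c K → NotRed c → NotRed (holeColour c K)
holeColour-notRed c hole        c≠red = c≠red
holeColour-notRed c (inL α K r) _     = holeColour-notRed blue K tt
holeColour-notRed c (inL β K r) _     = holeColour-notRed none K tt
holeColour-notRed c (inR α l K) _     = holeColour-notRed none K tt
holeColour-notRed c (inR β l K) _     = holeColour-notRed blue K tt

plug-end : ∀ K o t → o + width K + arity t ≡ o + arity (plug K t)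
plug-end K o t = trans (+-assoc o (width K) (arity t)) (cong (o +_) (sym (arity-plug K t)))

hole-end≤plug-end : ∀ K o I t → o + offset K ≡ I → I + arity t ≤ o + arity (plug K t)
hole-end≤plug-end K o I t refl =
  ≤-trans (≤-reflexive (+-assoc o (offset K) (arity t))) (+-monoʳ-≤ o (offset+arity≤arity-plug K t))

offset-inR : ∀ l K o I → o + (arity l + offset K) ≡ I → o + arity l + offset K ≡ I
offset-inR l K o I eq = trans (+-assoc o (arity l) (offset K)) eq

start≤hole-inR : ∀ l K o I → o + (arity l + offset K) ≡ I → o + arity l ≤ I
start≤hole-inR l K o I eq = subst (o + arity l ≤_) (offset-inR l K o I eq) (m≤m+n _ (offset K))

-- In the drawing at o of plug K t, the plugged tree t spans (I, I + arity t), where I = o + offset K;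
-- vertices after it are written x + arity t, so that they read as x + 1 in plug K leaf.
draw-plug-inside : ∀ K c o I t → o + offset K ≡ I → ∀ {p q} → I ≤ p → p < q → q ≤ I + arity t →
                   draw c (plug K t) o p q ≡ draw (holeColour c K) t I p q
draw-plug-inside hole c o I t eq _ _ _ = cong (λ x → draw c t x _ _) (trans (sym (+-identityʳ o)) eq)
draw-plug-inside (inL g K r) c o I t eq {p} {q} I≤p p<q q≤end =
  trans (draw-left c g (plug K t) r o p q (≤-trans q≤end (hole-end≤plug-end K o I t eq)))
        (draw-plug-inside K (leftColour g) o I t eq I≤p p<q q≤end)
draw-plug-inside (inR g l K) c o I t eq {p} {q} I≤p p<q q≤end =
  trans (draw-right c g l (plug K t) o p q (≤-trans (start≤hole-inR l K o I eq) I≤p) p<q)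
        (draw-plug-inside K (rightColour g) (o + arity l) I t (offset-inR l K o I eq) I≤p p<q q≤end)

draw-plug-before : ∀ K c o I t u → o + offset K ≡ I → ∀ {p q} → o ≤ p → p < q → q ≤ I →
                   draw c (plug K t) o p q ≡ draw c (plug K u) o p q
draw-plug-before hole c o I t u refl o≤p p<q q≤I =
  ⊥-elim (<⇒≱ p<q (≤-trans q≤I (≤-trans (≤-reflexive (+-identityʳ o)) o≤p)))
draw-plug-before (inL g K r) c o I t u eq {p} {q} o≤p p<q q≤I =
  begin
    draw c (plug (inL g K r) t) o p q ≡⟨ draw-left c g (plug K t) r o p q (below t) ⟩
    draw (leftColour g) (plug K t) o p q ≡⟨ draw-plug-before K (leftColour g) o I t u eq o≤p p<q q≤I ⟩
    draw (leftColour g) (plug K u) o p q ≡⟨ draw-left c g (plug K u) r o p q (below u) ⟨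
    draw c (plug (inL g K r) u) o p q ∎
  where
    open ≡-Reasoning
    below : ∀ t → q ≤ o + arity (plug K t)
    below t = ≤-trans q≤I (≤-trans (m≤m+n I (arity t)) (hole-end≤plug-end K o I t eq))
draw-plug-before (inR g l K) c o I t u eq {p} {q} o≤p p<q q≤I with q ≤? o + arity l | o + arity l ≤? p
... | yes q≤mid | _ =
  trans (draw-left c g l (plug K t) o p q q≤mid) (sym (draw-left c g l (plug K u) o p q q≤mid))
... | no _ | yes mid≤p =
  begin
    draw c (plug (inR g l K) t) o p q ≡⟨ draw-right c g l (plug K t) o p q mid≤p p<q ⟩
    draw (rightColour g) (plug K t) (o + arity l) p q
      ≡⟨ draw-plug-before K (rightColour g) (o + arity l) I t u (offset-inR l K o I eq) mid≤p p<q q≤I ⟩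
    draw (rightColour g) (plug K u) (o + arity l) p q ≡⟨ draw-right c g l (plug K u) o p q mid≤p p<q ⟨
    draw c (plug (inR g l K) u) o p q ∎
  where open ≡-Reasoning
... | no mid<q | no p<mid = trans (straddle t) (sym (straddle u))
  where
    straddle : ∀ t → draw c (plug (inR g l K) t) o p q ≡ none
    straddle t = draw-straddle c g l (plug K t) o p q (≰⇒> p<mid) (≰⇒> mid<q)
      (<⇒¬≡top (≤-<-trans q≤I (<-≤-trans (m<m+n I (1≤arity t))
                                          (hole-end≤plug-end (inR g l K) o I t eq))))

draw-shiftʳ : ∀ c t k o p q → draw c t (o + k) (p + k) (q + k) ≡ draw c t o p q
draw-shiftʳ c t k o p q rewrite +-comm o k | +-comm p k | +-comm q k = draw-shift c t k o p q

o≤hole : ∀ K o I → o + offset K ≡ I → o ≤ I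
o≤hole K o I eq = subst (o ≤_) eq (m≤m+n o (offset K))

draw-plug-after : ∀ K c o I t u → o + offset K ≡ I → ∀ {p q} → I ≤ p → p < q → q ≤ o + width K →
                  draw c (plug K t) o (p + arity t) (q + arity t) ≡ draw c (plug K u) o (p + arity u) (q + arity u)
draw-plug-after hole c o I t u refl I≤p p<q q≤end =
  ⊥-elim (<⇒≱ p<q (≤-trans q≤end I≤p))
draw-plug-after (inL g K r) c o I t u eq {p} {q} I≤p p<q q≤end with q ≤? o + width K | o + width K ≤? p
... | yes q≤mid | _ =
  begin
    draw c (plug (inL g K r) t) o (p + arity t) (q + arity t) ≡⟨ draw-left c g (plug K t) r o _ _ (inLeft t) ⟩
    draw (leftColour g) (plug K t) o (p + arity t) (q + arity t)
      ≡⟨ draw-plug-after K (leftColour g) o I t u eq I≤p p<q q≤mid ⟩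
    draw (leftColour g) (plug K u) o (p + arity u) (q + arity u)
      ≡⟨ draw-left c g (plug K u) r o _ _ (inLeft u) ⟨
    draw c (plug (inL g K r) u) o (p + arity u) (q + arity u) ∎
  where
    open ≡-Reasoning
    inLeft : ∀ t → q + arity t ≤ o + arity (plug K t)
    inLeft t = ≤-trans (+-monoˡ-≤ (arity t) q≤mid) (≤-reflexive (plug-end K o t))
... | no _ | yes mid≤p = trans (inRight t) (sym (inRight u))
  where
    inRight : ∀ t → draw c (plug (inL g K r) t) o (p + arity t) (q + arity t)
                    ≡ draw (rightColour g) r (o + width K) p q
    inRight t =
      begin
        draw c (plug (inL g K r) t) o (p + arity t) (q + arity t)
          ≡⟨ draw-right c g (plug K t) r o _ _
               (subst (_≤ p + arity t) (plug-end K o t) (+-monoˡ-≤ (arity t) mid≤p))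
                                                  (+-monoˡ-< (arity t) p<q) ⟩
        draw (rightColour g) r (o + arity (plug K t)) (p + arity t) (q + arity t)
          ≡⟨ cong (λ x → draw (rightColour g) r x (p + arity t) (q + arity t)) (plug-end K o t) ⟨
        draw (rightColour g) r (o + width K + arity t) (p + arity t) (q + arity t)
          ≡⟨ draw-shiftʳ (rightColour g) r (arity t) (o + width K) p q ⟩
        draw (rightColour g) r (o + width K) p q ∎
      where open ≡-Reasoning
... | no mid<q | no p<mid = trans (straddle t) (sym (straddle u))
  where
    straddle : ∀ t → draw c (plug (inL g K r) t) o (p + arity t) (q + arity t) ≡ none
    straddle t = draw-straddle c g (plug K t) r o _ _
      (subst (p + arity t <_) (plug-end K o t) (+-monoˡ-< (arity t) (≰⇒> p<mid)))
      (subst (_< q + arity t) (plug-end K o t) (+-monoˡ-< (arity t) (≰⇒> mid<q)))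
      (>⇒¬≡bottom (≤-<-trans (≤-trans (o≤hole K o I eq) I≤p) (m<m+n p (1≤arity t))))
draw-plug-after (inR g l K) c o I t u eq {p} {q} I≤p p<q q≤end =
  begin
    draw c (plug (inR g l K) t) o (p + arity t) (q + arity t)
      ≡⟨ draw-right c g l (plug K t) o _ _ (inRight t) (+-monoˡ-< (arity t) p<q) ⟩
    draw (rightColour g) (plug K t) (o + arity l) (p + arity t) (q + arity t)
      ≡⟨ draw-plug-after K (rightColour g) (o + arity l) I t u (offset-inR l K o I eq) I≤p p<q
                         (≤-trans q≤end (≤-reflexive (sym (+-assoc o (arity l) (width K))))) ⟩
    draw (rightColour g) (plug K u) (o + arity l) (p + arity u) (q + arity u)
      ≡⟨ draw-right c g l (plug K u) o _ _ (inRight u) (+-monoˡ-< (arity u) p<q) ⟨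
    draw c (plug (inR g l K) u) o (p + arity u) (q + arity u) ∎
  where
    open ≡-Reasoning
    inRight : ∀ t → o + arity l ≤ p + arity t
    inRight t = ≤-trans (start≤hole-inR l K o I eq) (≤-trans I≤p (m≤m+n p (arity t)))

draw-plug-base : ∀ K c o t {p q} → p ≡ o → q ≡ o + width K → draw c (plug K t) o p (q + arity t) ≡ c
draw-plug-base K c o t refl refl = trans (cong (draw c (plug K t) o o) (plug-end K o t)) (draw-base c (plug K t) o)

¬base-plug : ∀ K o t {p q} → ¬ (p ≡ o × q ≡ o + width K) →
             ¬ (p ≡ o × q + arity t ≡ o + arity (plug K t))
¬base-plug K o t ¬base (p≡o , q+t≡end) =
  ¬base (p≡o , +-cancelʳ-≡ (arity t) _ _ (trans q+t≡end (sym (plug-end K o t))))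

draw-plug-around : ∀ K c o I t u → o + offset K ≡ I →
                   ∀ {p q} → o ≤ p → p ≤ I → I ≤ q → q ≤ o + width K →
                   draw c (plug K t) o p (q + arity t) ≡ draw c (plug K u) o p (q + arity u)
draw-plug-around hole c o I t u refl {p} {q} o≤p p≤I I≤q q≤end =
  trans (draw-plug-base hole c o t p≡o q≡o) (sym (draw-plug-base hole c o u p≡o q≡o))
  where
    p≡o : p ≡ o
    p≡o = ≤-antisym (≤-trans p≤I (≤-reflexive (+-identityʳ o))) o≤p
    q≡o : q ≡ o + 0
    q≡o = ≤-antisym q≤end I≤q
draw-plug-around K@(inL g K' r) c o I t u eq {p} {q} o≤p p≤I I≤q q≤end
  with (p ≟ o) ×-dec (q ≟ o + width K)
... | yes (p≡o , q≡end) =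
  trans (draw-plug-base K c o t p≡o q≡end) (sym (draw-plug-base K c o u p≡o q≡end))
... | no ¬base with q ≤? o + width K'
...   | yes q≤mid =
  begin
    draw c (plug K t) o p (q + arity t) ≡⟨ draw-left c g (plug K' t) r o _ _ (inLeft t) ⟩
    draw (leftColour g) (plug K' t) o p (q + arity t)
      ≡⟨ draw-plug-around K' (leftColour g) o I t u eq o≤p p≤I I≤q q≤mid ⟩
    draw (leftColour g) (plug K' u) o p (q + arity u) ≡⟨ draw-left c g (plug K' u) r o _ _ (inLeft u) ⟨
    draw c (plug K u) o p (q + arity u) ∎
  where
    open ≡-Reasoning
    inLeft : ∀ t → q + arity t ≤ o + arity (plug K' t)
    inLeft t = ≤-trans (+-monoˡ-≤ (arity t) q≤mid) (≤-reflexive (plug-end K' o t))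
...   | no mid<q = trans (straddle t) (sym (straddle u))
  where
    straddle : ∀ t → draw c (plug K t) o p (q + arity t) ≡ none
    straddle t = draw-straddle c g (plug K' t) r o _ _
      (≤-<-trans p≤I (<-≤-trans (m<m+n I (1≤arity t)) (hole-end≤plug-end K' o I t eq)))
      (subst (_< q + arity t) (plug-end K' o t) (+-monoˡ-< (arity t) (≰⇒> mid<q)))
      (¬base-plug K o t ¬base)
draw-plug-around K@(inR g l K') c o I t u eq {p} {q} o≤p p≤I I≤q q≤end
  with (p ≟ o) ×-dec (q ≟ o + width K)
... | yes (p≡o , q≡end) =
  trans (draw-plug-base K c o t p≡o q≡end) (sym (draw-plug-base K c o u p≡o q≡end))
... | no ¬base with o + arity l ≤? p
...   | yes mid≤p =
  begin
    draw c (plug K t) o p (q + arity t) ≡⟨ draw-right c g l (plug K' t) o _ _ mid≤p (p<end t) ⟩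
    draw (rightColour g) (plug K' t) (o + arity l) p (q + arity t)
      ≡⟨ draw-plug-around K' (rightColour g) (o + arity l) I t u (offset-inR l K' o I eq) mid≤p p≤I I≤q
                          (≤-trans q≤end (≤-reflexive (sym (+-assoc o (arity l) (width K'))))) ⟩
    draw (rightColour g) (plug K' u) (o + arity l) p (q + arity u)
      ≡⟨ draw-right c g l (plug K' u) o _ _ mid≤p (p<end u) ⟨
    draw c (plug K u) o p (q + arity u) ∎
  where
    open ≡-Reasoning
    p<end : ∀ t → p < q + arity t
    p<end t = ≤-<-trans (≤-trans p≤I I≤q) (m<m+n q (1≤arity t))
...   | no p<mid = trans (straddle t) (sym (straddle u))
  where
    straddle : ∀ t → draw c (plug K t) o p (q + arity t) ≡ none
    straddle t = draw-straddle c g l (plug K' t) o _ _ (≰⇒> p<mid)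
      (≤-<-trans (≤-trans (start≤hole-inR l K' o I eq) I≤q) (m<m+n q (1≤arity t)))
      (¬base-plug K o t ¬base)

draw-plug-crossₗ : ∀ K c o I t → o + offset K ≡ I →
                   ∀ {p q} → o ≤ p → p < I → I < q → q < I + arity t →
                   draw c (plug K t) o p q ≡ none
draw-plug-crossₗ hole c o I t refl o≤p p<I _ _ =
  ⊥-elim (<⇒≱ p<I (≤-trans (≤-reflexive (+-identityʳ o)) o≤p))
draw-plug-crossₗ (inL g K r) c o I t eq {p} {q} o≤p p<I I<q q<end =
  trans (draw-left c g (plug K t) r o p q (≤-trans (<⇒≤ q<end) (hole-end≤plug-end K o I t eq)))
        (draw-plug-crossₗ K (leftColour g) o I t eq o≤p p<I I<q q<end)
draw-plug-crossₗ (inR g l K) c o I t eq {p} {q} o≤p p<I I<q q<end with o + arity l ≤? p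
... | yes mid≤p =
  trans (draw-right c g l (plug K t) o p q mid≤p (<-trans p<I I<q))
        (draw-plug-crossₗ K (rightColour g) (o + arity l) I t (offset-inR l K o I eq) mid≤p p<I I<q q<end)
... | no p<mid =
  draw-straddle c g l (plug K t) o p q (≰⇒> p<mid) (≤-<-trans (start≤hole-inR l K o I eq) I<q)
    (<⇒¬≡top (<-≤-trans q<end (hole-end≤plug-end (inR g l K) o I t eq)))

draw-plug-crossᵣ : ∀ K c o I t → o + offset K ≡ I →
                   ∀ {p q} → I < p → p < I + arity t → I < q → q ≤ o + width K →
                   draw c (plug K t) o p (q + arity t) ≡ none
draw-plug-crossᵣ hole c o I t refl _ _ I<q q≤end = ⊥-elim (<⇒≱ I<q q≤end)
draw-plug-crossᵣ (inL g K r) c o I t eq {p} {q} I<p p<end I<q q≤end with q ≤? o + width K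
... | yes q≤mid =
  trans (draw-left c g (plug K t) r o p _
           (≤-trans (+-monoˡ-≤ (arity t) q≤mid) (≤-reflexive (plug-end K o t))))
        (draw-plug-crossᵣ K (leftColour g) o I t eq I<p p<end I<q q≤mid)
... | no mid<q =
  draw-straddle c g (plug K t) r o p _ (<-≤-trans p<end (hole-end≤plug-end K o I t eq))
    (subst (_< q + arity t) (plug-end K o t) (+-monoˡ-< (arity t) (≰⇒> mid<q)))
    (>⇒¬≡bottom (≤-<-trans (o≤hole K o I eq) I<p))
draw-plug-crossᵣ (inR g l K) c o I t eq {p} {q} I<p p<end I<q q≤end =
  trans (draw-right c g l (plug K t) o p _ (≤-trans (start≤hole-inR l K o I eq) (<⇒≤ I<p))
                    (<-trans p<end (+-monoˡ-< (arity t) I<q)))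
        (draw-plug-crossᵣ K (rightColour g) (o + arity l) I t (offset-inR l K o I eq) I<p p<end I<q
                          (≤-trans q≤end (≤-reflexive (sym (+-assoc o (arity l) (width K))))))

-- The arcs of C ∘ᵢ D, D of size m, by their position relative to the copy (i, i + m) of the
-- base of D; a vertex x + m beyond that copy comes from vertex x + 1 of C.
data CompArc (i m : ℕ) : ℕ → ℕ → Set where
  before : ∀ {p q} → p < q → q ≤ i → CompArc i m p q
  after  : ∀ {p q} → i ≤ p → p < q → CompArc i m (p + m) (q + m)
  around : ∀ {p q} → p ≤ i → i ≤ q → ¬ (p ≡ i × q ≡ i) → CompArc i m p (q + m)
  glued  : CompArc i m i (i + m)
  inside : ∀ {p q} → i ≤ p → p < q → q ≤ i + m → ¬ (p ≡ i × q ≡ i + m) → CompArc i m p q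
  crossₗ : ∀ {p q} → p < i → i < q → q < i + m → CompArc i m p q
  crossᵣ : ∀ {p q} → i < p → p < i + m → i < q → CompArc i m p (q + m)

compArcColour : ∀ {i m p q} → CompArc i m p q → Col → Col → Colour
compArcColour {p = p} {q} (before _ _)       C D = C p q
compArcColour (after {p} {q} _ _)            C D = C (p + 1) (q + 1)
compArcColour (around {p} {q} _ _ _)         C D = C p (q + 1)
compArcColour {i} {m} glued                  C D = glue (C i (suc i)) (D 1 (suc m))
compArcColour {i} {p = p} {q} (inside _ _ _ _) C D = D (suc (p ∸ i)) (suc (q ∸ i))
compArcColour (crossₗ _ _ _)                 C D = none
compArcColour (crossᵣ _ _ _)                 C D = none

[p+m]∸[m∸1]≡p+1 : ∀ m p → 1 ≤ m → p + m ∸ (m ∸ 1) ≡ p + 1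
[p+m]∸[m∸1]≡p+1 (suc m) p _ = begin
  p + suc m ∸ m   ≡⟨ cong (_∸ m) (+-suc p m) ⟩
  suc p + m ∸ m   ≡⟨ m+n∸n≡m (suc p) m ⟩
  suc p           ≡⟨ +-comm 1 p ⟩
  p + 1           ∎
  where open ≡-Reasoning

compB-by-arc : ∀ {i m p q} (a : CompArc i m p q) → 1 ≤ m → ∀ C D →
               compB m i C D p q ≡ compArcColour a C D
compB-by-arc {i} {m} (before {p} {q} p<q q≤i) _ C D
  rewrite >⇒≤ᵇ-false (<-≤-trans p<q q≤i) | ≤⇒≤ᵇ-true (<⇒≤ (<-≤-trans p<q q≤i)) | ≤⇒≤ᵇ-true q≤i = refl
compB-by-arc {i} {m} (after {p} {q} i≤p p<q) 1≤m C D
  rewrite ≤⇒≤ᵇ-true (≤-trans i≤p (m≤m+n p m))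
        | >⇒≤ᵇ-false (+-monoˡ-< m (≤-<-trans i≤p p<q))
        | >⇒≤ᵇ-false {p + m} {i} (≤-<-trans i≤p (m<m+n p 1≤m))
        | >⇒≤ᵇ-false {q + m} {i} (<-trans (≤-<-trans i≤p p<q) (m<m+n q 1≤m))
        | ≤⇒≤ᵇ-true (+-monoˡ-≤ m i≤p) | ≤⇒≤ᵇ-true (+-monoˡ-≤ m (<⇒≤ (≤-<-trans i≤p p<q)))
        | [p+m]∸[m∸1]≡p+1 m p 1≤m | [p+m]∸[m∸1]≡p+1 m q 1≤m = refl
compB-by-arc {i} {m} (around {p} {q} p≤i i≤q ¬ii) 1≤m C D
  rewrite >⇒≤ᵇ-false {q + m} {i} (≤-<-trans i≤q (m<m+n q 1≤m)) | ≤⇒≤ᵇ-true (+-monoˡ-≤ m i≤q)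
        | [p+m]∸[m∸1]≡p+1 m q 1≤m with m≤n⇒m<n∨m≡n p≤i
... | inj₁ p<i rewrite >⇒≤ᵇ-false p<i | ≤⇒≤ᵇ-true p≤i = refl
... | inj₂ refl rewrite ≤⇒≤ᵇ-true (≤-refl {p})
                      | >⇒≤ᵇ-false (+-monoˡ-< m (≤∧≢⇒< i≤q (λ p≡q → ¬ii (refl , sym p≡q)))) = refl
compB-by-arc {i} {m} glued 1≤m C D
  rewrite ≤⇒≤ᵇ-true (≤-refl {i}) | ≤⇒≤ᵇ-true (≤-refl {i + m}) | pair-≡ᵇ-true i (i + m) = refl
compB-by-arc {i} {m} (inside {p} {q} i≤p p<q q≤end ¬glued) _ C D
  rewrite ≤⇒≤ᵇ-true i≤p | ≤⇒≤ᵇ-true q≤end | pair-≡ᵇ-false ¬glued = refl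
compB-by-arc {i} {m} (crossₗ {p} {q} p<i i<q q<end) _ C D
  rewrite >⇒≤ᵇ-false p<i | ≤⇒≤ᵇ-true (<⇒≤ p<i) | >⇒≤ᵇ-false i<q | >⇒≤ᵇ-false q<end = refl
compB-by-arc {i} {m} (crossᵣ {p} {q} i<p p<end i<q) 1≤m C D
  rewrite ≤⇒≤ᵇ-true (<⇒≤ i<p) | >⇒≤ᵇ-false (+-monoˡ-< m i<q) | >⇒≤ᵇ-false i<p | >⇒≤ᵇ-false p<end = refl

shifted-by : ∀ {m x} → m ≤ x → Σ ℕ (λ y → y + m ≡ x)
shifted-by {m} {x} m≤x = x ∸ m , m∸n+n≡m m≤x

compArc : ∀ i m p q → 1 ≤ m → p < q → CompArc i m p q
compArc i m p q 1≤m p<q with p <? i | q ≤? i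
... | yes p<i | yes q≤i = before p<q q≤i
... | yes p<i | no i≮q with q <? i + m
...   | yes q<end = crossₗ p<i (≰⇒> i≮q) q<end
...   | no q≮end with shifted-by (m+n≤o⇒n≤o i (≮⇒≥ q≮end))
...     | y , refl = around (<⇒≤ p<i) (+-cancelʳ-≤ m i y (≮⇒≥ q≮end)) (λ (p≡i , _) → <-irrefl p≡i p<i)
compArc i m p q 1≤m p<q | no p≮i | _ with q ≤? i + m | (p ≟ i) ×-dec (q ≟ i + m)
... | _        | yes (refl , refl) = glued
... | yes q≤end | no ¬glued = inside (≮⇒≥ p≮i) p<q q≤end ¬glued
... | no q≰end | no _ with shifted-by (m+n≤o⇒n≤o i (<⇒≤ (≰⇒> q≰end))) | p ≟ i
...   | y , refl | yes refl = around ≤-refl (<⇒≤ p<y) (λ (_ , y≡p) → <-irrefl (sym y≡p) p<y)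
  where
    p<y : p < y
    p<y = +-cancelʳ-< m p y (≰⇒> q≰end)
...   | y , refl | no p≢i with p <? i + m
...     | yes p<end = crossᵣ (≤∧≢⇒< (≮⇒≥ p≮i) (p≢i ∘ sym)) p<end (+-cancelʳ-< m i y (≰⇒> q≰end))
...     | no p≮end with shifted-by (m+n≤o⇒n≤o i (≮⇒≥ p≮end))
...       | x , refl = after (+-cancelʳ-≤ m i x (≮⇒≥ p≮end)) (+-cancelʳ-< m x y p<q)

+1≤suc : ∀ {q n} → q ≤ n → q + 1 ≤ suc n
+1≤suc {q} {n} q≤n = subst (_≤ suc n) (+-comm 1 q) (s≤s q≤n)

compArcColour-resp : ∀ {n m i p q} (a : CompArc i m p q) {C C' D D'} → C ≈B[ n ] C' → D ≈B[ m ] D' →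
                     1 ≤ i → i ≤ n → 1 ≤ m → 1 ≤ p → q ≤ n + m →
                     compArcColour a C D ≡ compArcColour a C' D'
compArcColour-resp {n} (before p<q q≤i) C≈ D≈ _ i≤n _ 1≤p _ =
  C≈ _ _ 1≤p p<q (≤-trans q≤i (≤-trans i≤n (n≤1+n n)))
compArcColour-resp {n} {m} (after {p} {q} i≤p p<q) C≈ D≈ _ _ _ _ q≤end =
  C≈ (p + 1) (q + 1) (m≤n+m 1 p) (+-monoˡ-< 1 p<q) (+1≤suc (+-cancelʳ-≤ m q n q≤end))
compArcColour-resp {n} {m} (around {p} {q} p≤i i≤q _) C≈ D≈ _ _ _ 1≤p q≤end =
  C≈ p (q + 1) 1≤p (≤-<-trans (≤-trans p≤i i≤q) (m<m+n q ≤-refl)) (+1≤suc (+-cancelʳ-≤ m q n q≤end))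
compArcColour-resp {n} {m} {i} glued C≈ D≈ 1≤i i≤n 1≤m _ _ =
  cong₂ glue (C≈ i (suc i) 1≤i ≤-refl (s≤s i≤n)) (D≈ 1 (suc m) ≤-refl (s≤s 1≤m) ≤-refl)
compArcColour-resp {n} {m} {i} (inside {p} {q} i≤p p<q q≤end _) C≈ D≈ _ _ _ _ _ =
  D≈ (suc (p ∸ i)) (suc (q ∸ i)) (s≤s z≤n) (s≤s (∸-monoˡ-< p<q i≤p)) (s≤s (m≤n+o⇒m∸n≤o q i q≤end))
compArcColour-resp (crossₗ _ _ _) _ _ _ _ _ _ _ = refl
compArcColour-resp (crossᵣ _ _ _) _ _ _ _ _ _ _ = refl

suc[n∸1]≡n : ∀ {x} → 1 ≤ x → suc (x ∸ 1) ≡ x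
suc[n∸1]≡n = m+[n∸m]≡n

compB-resp-≈B : ∀ n m i {C C' D D'} → C ≈B[ n ] C' → D ≈B[ m ] D' → 1 ≤ i → i ≤ n → 1 ≤ m →
                compB m i C D ≈B[ n + m ∸ 1 ] compB m i C' D'
compB-resp-≈B n m i {C} {C'} {D} {D'} C≈ D≈ 1≤i i≤n 1≤m p q 1≤p p<q q≤end =
  begin
    compB m i C D p q        ≡⟨ compB-by-arc a 1≤m C D ⟩
    compArcColour a C D
      ≡⟨ compArcColour-resp a C≈ D≈ 1≤i i≤n 1≤m 1≤p (subst (q ≤_) (suc[n∸1]≡n 1≤n+m) q≤end) ⟩
    compArcColour a C' D'    ≡⟨ compB-by-arc a 1≤m C' D' ⟨
    compB m i C' D' p q      ∎
  where
    open ≡-Reasoning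
    a = compArc i m p q 1≤m p<q
    1≤n+m : 1 ≤ n + m
    1≤n+m = ≤-trans 1≤m (m≤n+m m n)

arity-plug-leaf : ∀ K → arity (plug K leaf) ≡ 1 + width K
arity-plug-leaf K = trans (arity-plug K leaf) (+-comm (width K) 1)

plug-holeColour : ∀ K c o I t → o + offset K ≡ I → draw c (plug K t) o I (I + arity t) ≡ holeColour c K
plug-holeColour K c o I t eq =
  trans (draw-plug-inside K c o I t eq ≤-refl (m<m+n I (1≤arity t)) ≤-refl) (draw-base (holeColour c K) t I)

m+suc[n∸suc[m]]≡n : ∀ k p → suc k ≤ p → k + suc (p ∸ suc k) ≡ p
m+suc[n∸suc[m]]≡n k p sk≤p = trans (+-suc k (p ∸ suc k)) (m+[n∸m]≡n sk≤p)

shifted-end≤width : ∀ K t {q} → q + arity t ≤ arity (plug K leaf) + arity t → q ≤ 1 + width K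
shifted-end≤width K t q≤end = subst (_ ≤_) (arity-plug-leaf K) (+-cancelʳ-≤ (arity t) _ _ q≤end)

compArcColour-drawing : ∀ K t {p q} (a : CompArc (suc (offset K)) (arity t) p q) → 1 ≤ p →
                        q ≤ arity (plug K leaf) + arity t →
                        compArcColour a (drawing (plug K leaf)) (drawing t) ≡ drawing (plug K t) p q
compArcColour-drawing K t (before p<q q≤I) 1≤p _ =
  sym (draw-plug-before K blue 1 _ t leaf refl 1≤p p<q q≤I)
compArcColour-drawing K t (after {p} {q} I≤p p<q) _ q≤end =
  sym (draw-plug-after K blue 1 _ t leaf refl I≤p p<q (shifted-end≤width K t q≤end))
compArcColour-drawing K t (around {p} {q} p≤I I≤q _) 1≤p q≤end =
  sym (draw-plug-around K blue 1 _ t leaf refl 1≤p p≤I I≤q (shifted-end≤width K t q≤end))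
compArcColour-drawing K t glued _ _ =
  begin
    glue (drawing (plug K leaf) I (suc I)) (drawing t 1 (suc (arity t)))
      ≡⟨ cong₂ glue (trans (cong (drawing (plug K leaf) I) (+-comm 1 I)) (plug-holeColour K blue 1 I leaf refl))
                    (draw-base blue t 1) ⟩
    glue (holeColour blue K) blue ≡⟨ glue-blue _ (holeColour-notRed blue K tt) ⟩
    holeColour blue K ≡⟨ plug-holeColour K blue 1 I t refl ⟨
    drawing (plug K t) I (I + arity t) ∎
  where
    open ≡-Reasoning
    I = suc (offset K)
compArcColour-drawing K t (inside {p} {q} I≤p p<q q≤end ¬glued) _ _ =
  begin
    draw blue t 1 (suc (p ∸ I)) (suc (q ∸ I))
      ≡⟨ draw-shift blue t (offset K) 1 _ _ ⟨
    draw blue t (offset K + 1) (offset K + suc (p ∸ I)) (offset K + suc (q ∸ I))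
      ≡⟨ cong₂ (draw blue t (offset K + 1)) (m+suc[n∸suc[m]]≡n (offset K) p I≤p)
                                             (m+suc[n∸suc[m]]≡n (offset K) q (≤-trans I≤p (<⇒≤ p<q))) ⟩
    draw blue t (offset K + 1) p q
      ≡⟨ cong (λ x → draw blue t x p q) (+-comm (offset K) 1) ⟩
    draw blue t I p q
      ≡⟨ draw-base-irrelevant blue (holeColour blue K) t I p q ¬glued ⟩
    draw (holeColour blue K) t I p q
      ≡⟨ draw-plug-inside K blue 1 I t refl I≤p p<q q≤end ⟨
    drawing (plug K t) p q ∎
  where
    open ≡-Reasoning
    I = suc (offset K)
compArcColour-drawing K t (crossₗ p<I I<q q<end) 1≤p _ =
  sym (draw-plug-crossₗ K blue 1 _ t refl 1≤p p<I I<q q<end)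
compArcColour-drawing K t (crossᵣ I<p p<end I<q) _ q≤end =
  sym (draw-plug-crossᵣ K blue 1 _ t refl I<p p<end I<q (shifted-end≤width K t q≤end))

compB-drawing : ∀ K t → compB (arity t) (suc (offset K)) (drawing (plug K leaf)) (drawing t)
                          ≈B[ arity (plug K leaf) + arity t ∸ 1 ] drawing (plug K t)
compB-drawing K t p q 1≤p p<q q≤end =
  trans (compB-by-arc a (1≤arity t) _ _)
        (compArcColour-drawing K t a 1≤p
           (subst (q ≤_) (suc[n∸1]≡n (≤-trans (1≤arity t) (m≤n+m _ _))) q≤end))
  where a = compArc (suc (offset K)) (arity t) p q (1≤arity t) p<q

-- π is an operad morphism

≈B-refl : ∀ {n c} → c ≈B[ n ] c
≈B-refl _ _ _ _ _ = refl

≈B-sym : ∀ {n c d} → c ≈B[ n ] d → d ≈B[ n ] c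
≈B-sym c≈d p q 1≤p p<q q≤n = sym (c≈d p q 1≤p p<q q≤n)

≈B-trans : ∀ {n c d e} → c ≈B[ n ] d → d ≈B[ n ] e → c ≈B[ n ] e
≈B-trans c≈d d≈e p q 1≤p p<q q≤n = trans (c≈d p q 1≤p p<q q≤n) (d≈e p q 1≤p p<q q≤n)

≈B-cast : ∀ {n n' c d} → n ≡ n' → c ≈B[ n ] d → c ≈B[ n' ] d
≈B-cast refl c≈d = c≈d

≈B-size2 : ∀ {C D : Col} → C 1 2 ≡ D 1 2 → C 1 3 ≡ D 1 3 → C 2 3 ≡ D 2 3 → C ≈B[ 2 ] D
≈B-size2 e₁₂ e₁₃ e₂₃ 1 2 _ _ _ = e₁₂
≈B-size2 e₁₂ e₁₃ e₂₃ 1 3 _ _ _ = e₁₃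
≈B-size2 e₁₂ e₁₃ e₂₃ 2 3 _ _ _ = e₂₃
≈B-size2 e₁₂ e₁₃ e₂₃ 0 _ () _ _
≈B-size2 e₁₂ e₁₃ e₂₃ 1 0 _ () _
≈B-size2 e₁₂ e₁₃ e₂₃ 1 1 _ (s≤s ()) _
≈B-size2 e₁₂ e₁₃ e₂₃ 1 (suc (suc (suc (suc q)))) _ _ (s≤s (s≤s (s≤s ())))
≈B-size2 e₁₂ e₁₃ e₂₃ 2 0 _ () _
≈B-size2 e₁₂ e₁₃ e₂₃ 2 1 _ (s≤s ()) _
≈B-size2 e₁₂ e₁₃ e₂₃ 2 2 _ (s≤s (s≤s ())) _
≈B-size2 e₁₂ e₁₃ e₂₃ 2 (suc (suc (suc (suc q)))) _ _ (s≤s (s≤s (s≤s ())))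
≈B-size2 e₁₂ e₁₃ e₂₃ (suc (suc (suc p))) q _ p<q q≤3 =
  ⊥-elim (<⇒≱ (<-≤-trans (s≤s (s≤s (s≤s (s≤s z≤n)))) p<q) q≤3)

≈B-size3 : ∀ {C D : Col} → C 1 2 ≡ D 1 2 → C 1 3 ≡ D 1 3 → C 1 4 ≡ D 1 4 →
           C 2 3 ≡ D 2 3 → C 2 4 ≡ D 2 4 → C 3 4 ≡ D 3 4 → C ≈B[ 3 ] D
≈B-size3 e₁₂ e₁₃ e₁₄ e₂₃ e₂₄ e₃₄ 1 2 _ _ _ = e₁₂
≈B-size3 e₁₂ e₁₃ e₁₄ e₂₃ e₂₄ e₃₄ 1 3 _ _ _ = e₁₃
≈B-size3 e₁₂ e₁₃ e₁₄ e₂₃ e₂₄ e₃₄ 1 4 _ _ _ = e₁₄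
≈B-size3 e₁₂ e₁₃ e₁₄ e₂₃ e₂₄ e₃₄ 2 3 _ _ _ = e₂₃
≈B-size3 e₁₂ e₁₃ e₁₄ e₂₃ e₂₄ e₃₄ 2 4 _ _ _ = e₂₄
≈B-size3 e₁₂ e₁₃ e₁₄ e₂₃ e₂₄ e₃₄ 3 4 _ _ _ = e₃₄
≈B-size3 e₁₂ e₁₃ e₁₄ e₂₃ e₂₄ e₃₄ 0 _ () _ _
≈B-size3 e₁₂ e₁₃ e₁₄ e₂₃ e₂₄ e₃₄ (suc p) 0 _ () _
≈B-size3 e₁₂ e₁₃ e₁₄ e₂₃ e₂₄ e₃₄ 1 1 _ (s≤s ()) _
≈B-size3 e₁₂ e₁₃ e₁₄ e₂₃ e₂₄ e₃₄ 2 1 _ (s≤s ()) _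
≈B-size3 e₁₂ e₁₃ e₁₄ e₂₃ e₂₄ e₃₄ 2 2 _ (s≤s (s≤s ())) _
≈B-size3 e₁₂ e₁₃ e₁₄ e₂₃ e₂₄ e₃₄ 3 1 _ (s≤s ()) _
≈B-size3 e₁₂ e₁₃ e₁₄ e₂₃ e₂₄ e₃₄ 3 2 _ (s≤s (s≤s ())) _
≈B-size3 e₁₂ e₁₃ e₁₄ e₂₃ e₂₄ e₃₄ 3 3 _ (s≤s (s≤s (s≤s ()))) _
≈B-size3 e₁₂ e₁₃ e₁₄ e₂₃ e₂₄ e₃₄ (suc p) (suc (suc (suc (suc (suc q))))) _ _ (s≤s (s≤s (s≤s (s≤s ()))))
≈B-size3 e₁₂ e₁₃ e₁₄ e₂₃ e₂₄ e₃₄ (suc (suc (suc (suc p)))) q _ p<q q≤4 =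
  ⊥-elim (<⇒≱ (<-≤-trans (s≤s (s≤s (s≤s (s≤s (s≤s z≤n))))) p<q) q≤4)

τ≈drawing-gen : ∀ g → τ g ≈B[ 2 ] drawing (gen g)
τ≈drawing-gen α = ≈B-size2 refl refl refl
τ≈drawing-gen β = ≈B-size2 refl refl refl

π≈drawing : ∀ t → π t ≈B[ arity t ] drawing t
π≈drawing leaf = ≈B-refl
π≈drawing (node g l r) = ≈B-cast (+-comm (arity r) (arity l)) (≈B-trans
  (compB-resp-≈B (suc (arity r)) (arity l) 1 right≈ (π≈drawing l) ≤-refl (s≤s z≤n) (1≤arity l))
  (compB-drawing (inL g hole r) l))
  where
    right≈ : compB (arity r) 2 (τ g) (π r) ≈B[ suc (arity r) ] drawing (node g leaf r)
    right≈ = ≈B-trans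
      (compB-resp-≈B 2 (arity r) 2 (τ≈drawing-gen g) (π≈drawing r) (s≤s z≤n) ≤-refl (1≤arity r))
                      (compB-drawing (inR g leaf hole) r)

data LeafAt : Tree → ℕ → Set where
  at : ∀ K → LeafAt (plug K leaf) (suc (offset K))

leafAt-inR : ∀ g l {r j} → LeafAt r j → LeafAt (node g l r) (arity l + j)
leafAt-inR g l (at K) = subst (LeafAt _) (sym (+-suc (arity l) (offset K))) (at (inR g l K))

leafAt : ∀ s i → 1 ≤ i → i ≤ arity s → LeafAt s i
leafAt leaf i 1≤i i≤1 rewrite ≤-antisym i≤1 1≤i = at hole
leafAt (node g l r) i 1≤i i≤n with i ≤? arity l
... | yes i≤l with leafAt l i 1≤i i≤l
...   | at K = at (inL g K r)
leafAt (node g l r) i 1≤i i≤n | no i≰l =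
  subst (LeafAt _) (m+[n∸m]≡n (<⇒≤ l<i))
        (leafAt-inR g l (leafAt r (i ∸ arity l) (m<n⇒0<n∸m l<i) (m≤n+o⇒m∸n≤o i (arity l) i≤n)))
  where
    l<i : arity l < i
    l<i = ≰⇒> i≰l

graft-plug : ∀ K t → graft (plug K leaf) (suc (offset K)) t ≡ plug K t
graft-plug hole        t = refl
graft-plug (inL g K r) t
  rewrite ≤⇒≤ᵇ-true (≤-trans (≤-reflexive (+-comm 1 (offset K))) (offset+arity≤arity-plug K leaf))
  = cong (λ l → node g l r) (graft-plug K t)
graft-plug (inR g l K) t
  rewrite >⇒≤ᵇ-false {suc (arity l + offset K)} {arity l} (s≤s (m≤m+n (arity l) (offset K)))
        | +-∸-assoc 1 (m≤m+n (arity l) (offset K)) | m+n∸m≡n (arity l) (offset K)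
  = cong (node g l) (graft-plug K t)

arity-plug-∸ : ∀ K t → arity (plug K t) ≡ arity (plug K leaf) + arity t ∸ 1
arity-plug-∸ K t = begin
  arity (plug K t)                  ≡⟨ arity-plug K t ⟩
  width K + arity t                 ≡⟨ m+n∸n≡m (width K + arity t) 1 ⟨
  width K + arity t + 1 ∸ 1         ≡⟨ cong (_∸ 1) (+-swapʳ (width K) 1 (arity t)) ⟨
  width K + 1 + arity t ∸ 1         ≡⟨ cong (λ n → n + arity t ∸ 1) (arity-plug K leaf) ⟨
  arity (plug K leaf) + arity t ∸ 1 ∎
  where open ≡-Reasoning

arity-graft : ∀ s i t → 1 ≤ i → i ≤ arity s → arity (graft s i t) ≡ arity s + arity t ∸ 1
arity-graft s i t 1≤i i≤n with leafAt s i 1≤i i≤n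
... | at K rewrite graft-plug K t = arity-plug-∸ K t

π-graft : ∀ s i t → 1 ≤ i → i ≤ arity s →
          π (graft s i t) ≈B[ arity s + arity t ∸ 1 ] compB (arity t) i (π s) (π t)
π-graft s i t 1≤i i≤n with leafAt s i 1≤i i≤n
... | at K rewrite graft-plug K t =
  ≈B-trans (≈B-cast (arity-plug-∸ K t) (π≈drawing (plug K t)))
           (≈B-sym (≈B-trans (compB-resp-≈B _ (arity t) _ (π≈drawing (plug K leaf)) (π≈drawing t)
                                            1≤i i≤n (1≤arity t))
                             (compB-drawing K t)))

arity-resp-≡F : ∀ {s t} → s ≡F t → arity s ≡ arity t
arity-resp-≡F rel            = refl
arity-resp-≡F c-refl         = refl
arity-resp-≡F (c-sym s≡t)    = sym (arity-resp-≡F s≡t)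
arity-resp-≡F (c-trans s≡t t≡u) = trans (arity-resp-≡F s≡t) (arity-resp-≡F t≡u)
arity-resp-≡F (c-comp {s} {s'} {t} {t'} {i} s≡s' t≡t' 1≤i i≤n) = begin
  arity (graft s i t)             ≡⟨ arity-graft s i t 1≤i i≤n ⟩
  arity s + arity t ∸ 1           ≡⟨ cong₂ (λ m n → m + n ∸ 1) (arity-resp-≡F s≡s') (arity-resp-≡F t≡t') ⟩
  arity s' + arity t' ∸ 1         ≡⟨ arity-graft s' i t' 1≤i (subst (i ≤_) (arity-resp-≡F s≡s') i≤n) ⟨
  arity (graft s' i t')           ∎
  where open ≡-Reasoning

π-graft-cong : ∀ {s s' t t' i} → arity s ≡ arity s' → arity t ≡ arity t' →
               π s ≈B[ arity s ] π s' → π t ≈B[ arity t ] π t' → 1 ≤ i → i ≤ arity s →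
               π (graft s i t) ≈B[ arity (graft s i t) ] π (graft s' i t')
π-graft-cong {s} {s'} {t} {t'} {i} s≡s' t≡t' πs≈πs' πt≈πt' 1≤i i≤n =
  ≈B-cast (sym (arity-graft s i t 1≤i i≤n))
    (≈B-trans (π-graft s i t 1≤i i≤n)
    (≈B-trans (compB-resp-≈B (arity s) (arity t) i πs≈πs' πt≈πt' 1≤i i≤n (1≤arity t))
              (≈B-sym π-graft')))
  where
    π-graft' : π (graft s' i t') ≈B[ arity s + arity t ∸ 1 ] compB (arity t) i (π s') (π t')
    π-graft' = subst₂ (λ n m → π (graft s' i t') ≈B[ n + m ∸ 1 ] compB m i (π s') (π t'))
                      (sym s≡s') (sym t≡t') (π-graft s' i t' 1≤i (subst (i ≤_) s≡s' i≤n))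

π-resp-≡F : ∀ {s t} → s ≡F t → π s ≈B[ arity s ] π t
π-resp-≡F rel               = ≈B-size3 refl refl refl refl refl refl
π-resp-≡F c-refl            = ≈B-refl
π-resp-≡F (c-sym s≡t)       = ≈B-sym (≈B-cast (arity-resp-≡F s≡t) (π-resp-≡F s≡t))
π-resp-≡F (c-trans s≡t t≡u) =
  ≈B-trans (π-resp-≡F s≡t) (≈B-cast (sym (arity-resp-≡F s≡t)) (π-resp-≡F t≡u))
π-resp-≡F (c-comp {s} {s'} {t} {t'} s≡s' t≡t' 1≤i i≤n) =
  π-graft-cong {s} {s'} {t} {t'} (arity-resp-≡F s≡s') (arity-resp-≡F t≡t') (π-resp-≡F s≡s') (π-resp-≡F t≡t') 1≤i i≤n

InImage : ℕ → Col → Set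
InImage n c = Σ Tree (λ t → (arity t ≡ n) × (c ≈B[ n ] π t))

τ-inGen : ∀ g → InGen 2 (τ g)
τ-inGen α = g-aab
τ-inGen β = g-baa

π-inGen : ∀ t → InGen (arity t) (π t)
π-inGen leaf = g-unit
π-inGen (node g l r) = subst (λ n → InGen n (π (node g l r))) (+-comm (arity r) (arity l))
  (g-comp (g-comp (τ-inGen g) (π-inGen r) (s≤s z≤n) ≤-refl) (π-inGen l) ≤-refl (s≤s z≤n))

τ≈π-gen : ∀ g → τ g ≈B[ 2 ] π (gen g)
τ≈π-gen g = ≈B-trans (τ≈drawing-gen g) (≈B-sym (π≈drawing (gen g)))

InGen⇒InImage : ∀ {n c} → InGen n c → InImage n c
InGen⇒InImage g-unit = leaf , refl , ≈B-refl
InGen⇒InImage g-aab  = gen α , refl , τ≈π-gen α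
InGen⇒InImage g-baa  = gen β , refl , τ≈π-gen β
InGen⇒InImage (g-comp {i = i} {c} {d} c∈ d∈ 1≤i i≤n) with InGen⇒InImage c∈ | InGen⇒InImage d∈
... | s , refl , c≈πs | t , refl , d≈πt =
  graft s i t , arity-graft s i t 1≤i i≤n ,
  ≈B-trans (compB-resp-≈B (arity s) (arity t) i c≈πs d≈πt 1≤i i≤n (1≤arity t))
           (≈B-sym (π-graft s i t 1≤i i≤n))
InGen⇒InImage (g-resp c∈ c≈d) with InGen⇒InImage c∈
... | t , refl , c≈πt = t , refl , ≈B-trans (≈B-sym c≈d) c≈πt

InImage⇒InGen : ∀ {n c} → InImage n c → InGen n c
InImage⇒InGen (t , refl , c≈πt) = g-resp (π-inGen t) (≈B-sym c≈πt)

-- Normal forms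

node-cong : ∀ g {l l' r r'} → l ≡F l' → r ≡F r' → node g l r ≡F node g l' r'
node-cong g {r = r} {r'} l≡l' r≡r' =
  c-comp {node g leaf r} {node g leaf r'} (c-comp {gen g} {gen g} {i = 2} c-refl r≡r' (s≤s z≤n) ≤-refl)
         l≡l' ≤-refl (s≤s z≤n)

βα-rotate : ∀ u v y → node β (node α u v) y ≡F node α u (node β v y)
βα-rotate u v y =
  c-comp {i = 1} (c-comp {i = 2} (c-comp {i = 3} rel c-refl (s≤s z≤n) ≤-refl) c-refl (s≤s z≤n) (s≤s (s≤s z≤n)))
         c-refl ≤-refl (s≤s z≤n)

rotateβ : Tree → Tree → Tree
rotateβ (node α u v) y = node α u (rotateβ v y)
rotateβ x            y = node β x y

normalise : Tree → Tree
normalise leaf         = leaf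
normalise (node α l r) = node α (normalise l) (normalise r)
normalise (node β l r) = rotateβ (normalise l) (normalise r)

rotateβ≡F : ∀ x y → rotateβ x y ≡F node β x y
rotateβ≡F leaf         y = c-refl
rotateβ≡F (node α u v) y = c-trans (node-cong α c-refl (rotateβ≡F v y)) (c-sym (βα-rotate u v y))
rotateβ≡F (node β u v) y = c-refl

normalise≡F : ∀ s → normalise s ≡F s
normalise≡F leaf         = c-refl
normalise≡F (node α l r) = node-cong α (normalise≡F l) (normalise≡F r)
normalise≡F (node β l r) =
  c-trans (rotateβ≡F (normalise l) (normalise r)) (node-cong β (normalise≡F l) (normalise≡F r))

data βComb : Tree → Set where
  leaf : βComb leaf
  node : ∀ {l r} → βComb l → βComb (node β l r)

data Normal : Tree → Set where
  leaf  : Normal leaf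
  nodeα : ∀ {l r} → Normal l → Normal r → Normal (node α l r)
  nodeβ : ∀ {l r} → βComb l → Normal l → Normal r → Normal (node β l r)

rotateβ-normal : ∀ {x y} → Normal x → Normal y → Normal (rotateβ x y)
rotateβ-normal leaf                 ny = nodeβ leaf leaf ny
rotateβ-normal (nodeα nu nv)        ny = nodeα nu (rotateβ-normal nv ny)
rotateβ-normal (nodeβ cu nu nv)     ny = nodeβ (node cu) (nodeβ cu nu nv) ny

normalise-normal : ∀ s → Normal (normalise s)
normalise-normal leaf         = leaf
normalise-normal (node α l r) = nodeα (normalise-normal l) (normalise-normal r)
normalise-normal (node β l r) = rotateβ-normal (normalise-normal l) (normalise-normal r)

-- Injectivity on normal forms

draw-leftArc : ∀ c g l r o → draw c (node g l r) o o (o + arity l) ≡ leftColour g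
draw-leftArc c g l r o = trans (draw-left c g l r o o _ ≤-refl) (draw-base (leftColour g) l o)

draw-rightArc : ∀ c g l r o → draw c (node g l r) o (o + arity l) (o + (arity l + arity r)) ≡ rightColour g
draw-rightArc c g l r o =
  trans (draw-right c g l r o _ _ ≤-refl (+-monoʳ-< o (arity<arity+arity l r)))
        (trans (cong (draw (rightColour g) r (o + arity l) (o + arity l)) (sym (+-assoc o (arity l) (arity r))))
               (draw-base (rightColour g) r (o + arity l)))

draw-straddle-bottom : ∀ c g l r o k → arity l < k → k < arity l + arity r →
                       draw c (node g l r) o o (o + k) ≡ none
draw-straddle-bottom c g l r o k l<k k<n =
  draw-straddle c g l r o o (o + k) (m<m+n o (1≤arity l)) (+-monoʳ-< o l<k) (<⇒¬≡top (+-monoʳ-< o k<n))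

draw-straddle-top : ∀ c g l r o k → 0 < k → k < arity l →
                    draw c (node g l r) o (o + k) (o + (arity l + arity r)) ≡ none
draw-straddle-top c g l r o k 0<k k<l =
  draw-straddle c g l r o (o + k) _ (+-monoʳ-< o k<l) (+-monoʳ-< o (arity<arity+arity l r))
                (>⇒¬≡bottom (m<m+n o 0<k))

βComb-bottom : ∀ {u} → βComb u → ∀ o k → 1 ≤ k → k ≤ arity u → draw none u o o (o + k) ≡ none
βComb-bottom leaf o k 1≤k k≤1 rewrite ≤-antisym k≤1 1≤k = draw-base none leaf o
βComb-bottom (node {l} {r} cl) o k 1≤k k≤n with k ≤? arity l | k ≟ arity l + arity r
... | yes k≤l | _        =
  trans (draw-left none β l r o o (o + k) (+-monoʳ-≤ o k≤l)) (βComb-bottom cl o k 1≤k k≤l)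
... | no _    | yes refl = draw-base none (node β l r) o
... | no k≰l  | no k≢n   = draw-straddle-bottom none β l r o k (≰⇒> k≰l) (≤∧≢⇒< k≤n k≢n)

normal-bottom : ∀ {c g l r o k} → Normal (node g l r) → 1 ≤ k → k < arity l + arity r → g ≡ β ⊎ arity l < k →
                draw c (node g l r) o o (o + k) ≡ none
normal-bottom {c} {l = l} {r} {o} {k} (nodeα _ _) _ k<n (inj₂ l<k) = draw-straddle-bottom c α l r o k l<k k<n
normal-bottom {c} {l = l} {r} {o} {k} (nodeβ cl _ _) 1≤k k<n _ with k ≤? arity l
... | yes k≤l = trans (draw-left c β l r o o (o + k) (+-monoʳ-≤ o k≤l)) (βComb-bottom cl o k 1≤k k≤l)
... | no k≰l  = draw-straddle-bottom c β l r o k (≰⇒> k≰l) k<n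

record Agree (c : Colour) (o : ℕ) (s t : Tree) : Set where
  constructor agreeing
  field agree : ∀ p q → o ≤ p → p < q → q ≤ o + arity s → draw c s o p q ≡ draw c t o p q
open Agree

agree-sym : ∀ {c o s t} → arity s ≡ arity t → Agree c o s t → Agree c o t s
agree-sym s≡t (agreeing s≈t) =
  agreeing λ p q o≤p p<q q≤end → sym (s≈t p q o≤p p<q (subst (λ n → q ≤ _ + n) (sym s≡t) q≤end))

agree-clash : ∀ {c o s t p q} → Agree c o s t → o ≤ p → p < q → q ≤ o + arity s →
              draw c s o p q ≡ blue → draw c t o p q ≡ none → ⊥
agree-clash s≈t o≤p p<q q≤end s-blue t-none
  with trans (sym s-blue) (trans (agree s≈t _ _ o≤p p<q q≤end) t-none)
... | ()

α-split-maximal : ∀ {c o l r g' l' r'} → Normal (node g' l' r') → arity l + arity r ≡ arity l' + arity r' →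
                  Agree c o (node α l r) (node g' l' r') → g' ≡ β ⊎ arity l' < arity l → ⊥
α-split-maximal {c} {o} {l} {r} normal n≡n' s≈t β⊎l'<l =
  agree-clash s≈t ≤-refl (m<m+n o (1≤arity l)) (+-monoʳ-≤ o (<⇒≤ (arity<arity+arity l r)))
    (draw-leftArc c α l r o)
    (normal-bottom {c} {o = o} normal (1≤arity l) (subst (arity l <_) n≡n' (arity<arity+arity l r)) β⊎l'<l)

β-split-minimal : ∀ {c o l r l' r'} → arity l + arity r ≡ arity l' + arity r' →
                  Agree c o (node β l r) (node β l' r') → arity l < arity l' → ⊥
β-split-minimal {c} {o} {l} {r} {l'} {r'} n≡n' s≈t l<l' =
  agree-clash s≈t (m≤m+n o (arity l)) (+-monoʳ-< o (arity<arity+arity l r)) ≤-refl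
    (draw-rightArc c β l r o)
    (subst (λ n → draw c (node β l' r') o (o + arity l) (o + n) ≡ none) (sym n≡n')
           (draw-straddle-top c β l' r' o (arity l) (1≤arity l) l<l'))

root-determined : ∀ {c o g l r g' l' r'} → Normal (node g l r) → Normal (node g' l' r') →
                  arity l + arity r ≡ arity l' + arity r' → Agree c o (node g l r) (node g' l' r') →
                  g ≡ g' × arity l ≡ arity l'
root-determined {g = α} {l = l} {g' = α} {l'} ns nt n≡n' s≈t with <-cmp (arity l) (arity l')
... | tri< l<l' _ _ = ⊥-elim (α-split-maximal ns (sym n≡n') (agree-sym n≡n' s≈t) (inj₂ l<l'))
... | tri≈ _ l≡l' _ = refl , l≡l'
... | tri> _ _ l'<l = ⊥-elim (α-split-maximal nt n≡n' s≈t (inj₂ l'<l))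
root-determined {g = α} {g' = β} ns nt n≡n' s≈t = ⊥-elim (α-split-maximal nt n≡n' s≈t (inj₁ refl))
root-determined {g = β} {g' = α} ns nt n≡n' s≈t =
  ⊥-elim (α-split-maximal ns (sym n≡n') (agree-sym n≡n' s≈t) (inj₁ refl))
root-determined {g = β} {l = l} {g' = β} {l'} ns nt n≡n' s≈t with <-cmp (arity l) (arity l')
... | tri< l<l' _ _ = ⊥-elim (β-split-minimal n≡n' s≈t l<l')
... | tri≈ _ l≡l' _ = refl , l≡l'
... | tri> _ _ l'<l = ⊥-elim (β-split-minimal (sym n≡n') (agree-sym n≡n' s≈t) l'<l)

agree-left : ∀ {c o g l r l' r'} → arity l ≡ arity l' → Agree c o (node g l r) (node g l' r') →
             Agree (leftColour g) o l l'
agree-left {c} {o} {g} {l} {r} {l'} {r'} l≡l' s≈t = agreeing λ p q o≤p p<q q≤end → begin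
  draw (leftColour g) l o p q   ≡⟨ draw-left c g l r o p q q≤end ⟨
  draw c (node g l r) o p q
    ≡⟨ agree s≈t p q o≤p p<q (≤-trans q≤end (+-monoʳ-≤ o (m≤m+n (arity l) (arity r)))) ⟩
  draw c (node g l' r') o p q   ≡⟨ draw-left c g l' r' o p q (subst (λ n → q ≤ o + n) l≡l' q≤end) ⟩
  draw (leftColour g) l' o p q  ∎
  where open ≡-Reasoning

agree-right : ∀ {c o g l r l' r'} → arity l ≡ arity l' → Agree c o (node g l r) (node g l' r') →
              Agree (rightColour g) (o + arity l) r r'
agree-right {c} {o} {g} {l} {r} {l'} {r'} l≡l' s≈t = agreeing λ p q mid≤p p<q q≤end → begin
  draw (rightColour g) r (o + arity l) p q
    ≡⟨ draw-right c g l r o p q mid≤p p<q ⟨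
  draw c (node g l r) o p q
    ≡⟨ agree s≈t p q (≤-trans (m≤m+n o (arity l)) mid≤p) p<q
                 (subst (q ≤_) (+-assoc o (arity l) (arity r)) q≤end) ⟩
  draw c (node g l' r') o p q
    ≡⟨ draw-right c g l' r' o p q (subst (λ n → o + n ≤ p) l≡l' mid≤p) p<q ⟩
  draw (rightColour g) r' (o + arity l') p q
    ≡⟨ cong (λ n → draw (rightColour g) r' (o + n) p q) l≡l' ⟨
  draw (rightColour g) r' (o + arity l) p q ∎
  where open ≡-Reasoning

normal-left : ∀ {g l r} → Normal (node g l r) → Normal l
normal-left (nodeα nl _)   = nl
normal-left (nodeβ _ nl _) = nl

normal-right : ∀ {g l r} → Normal (node g l r) → Normal r
normal-right (nodeα _ nr)   = nr
normal-right (nodeβ _ _ nr) = nr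

normal-agree-injective : ∀ {c o s t} → Normal s → Normal t → arity s ≡ arity t → Agree c o s t → s ≡ t
normal-agree-injective {s = leaf}       {leaf}         _ _ _ _ = refl
normal-agree-injective {s = leaf}       {node g l r}   _ _ 1≡n _ =
  ⊥-elim (<⇒≱ (2≤arity+arity l r) (≤-reflexive (sym 1≡n)))
normal-agree-injective {s = node g l r} {leaf}         _ _ n≡1 _ =
  ⊥-elim (<⇒≱ (2≤arity+arity l r) (≤-reflexive n≡1))
normal-agree-injective {s = node g l r} {node g' l' r'} ns nt n≡n' s≈t with root-determined ns nt n≡n' s≈t
... | refl , l≡l' =
  cong₂ (node g) (normal-agree-injective (normal-left ns) (normal-left nt) l≡l' (agree-left l≡l' s≈t))
                 (normal-agree-injective (normal-right ns) (normal-right nt) r≡r' (agree-right l≡l' s≈t))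
  where
    r≡r' : arity r ≡ arity r'
    r≡r' = +-cancelˡ-≡ (arity l) (arity r) (arity r') (trans n≡n' (cong (_+ arity r') (sym l≡l')))

π-≈B⇒≡F : ∀ s t → arity s ≡ arity t → π s ≈B[ arity s ] π t → s ≡F t
π-≈B⇒≡F s t s≡t πs≈πt =
  c-trans (c-sym (normalise≡F s)) (subst (_≡F t) (sym normal-forms-equal) (normalise≡F t))
  where
    s₀≡s : arity (normalise s) ≡ arity s
    s₀≡s = arity-resp-≡F (normalise≡F s)
    t₀≡s : arity (normalise t) ≡ arity s
    t₀≡s = trans (arity-resp-≡F (normalise≡F t)) (sym s≡t)
    drawings≈ : drawing (normalise s) ≈B[ arity s ] drawing (normalise t)
    drawings≈ = ≈B-trans (≈B-cast s₀≡s (≈B-sym (π≈drawing (normalise s))))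
                (≈B-trans (≈B-cast s₀≡s (π-resp-≡F (normalise≡F s)))
                (≈B-trans πs≈πt
                (≈B-trans (≈B-cast t₀≡s (≈B-sym (π-resp-≡F (normalise≡F t))))
                          (≈B-cast t₀≡s (π≈drawing (normalise t))))))
    normal-forms-equal : normalise s ≡ normalise t
    normal-forms-equal =
      normal-agree-injective (normalise-normal s) (normalise-normal t) (trans s₀≡s (sym t₀≡s))
                             (agreeing (≈B-cast (sym s₀≡s) drawings≈))

mainTheorem15 : ((s t : Tree) → arity s ≡ arity t → ((π s ≈B[ arity s ] π t) ⇔ (s ≡F t)))
    ×
    ((n : ℕ) (c : Col) → (InGen n c ⇔ Σ Tree (λ t → (arity t ≡ n) × (c ≈B[ n ] π t))))
mainTheorem15 =
  (λ s t s≡t → mk⇔ (π-≈B⇒≡F s t s≡t) π-resp-≡F) ,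
  (λ n c → mk⇔ InGen⇒InImage InImage⇒InGen)
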